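{- If $G$ is a graph on $n$ vertices with independence number $\alpha$, then $\mathrm{th}_{\mathrm{H}}(G)\leq \lceil n-\alpha+2\sqrt{\alpha}-1\rceil$.
   Context: All graphs are finite, simple and undirected; $N(v)$ is the open neighborhood of $v$. Vertices are colored blue or white. Under the hopping color change rule, a blue vertex $v$ may force a white vertex $w$ (not necessarily adjacent to $v$) to become blue provided $v$ has not previously performed a force and every vertex of $N(v)$ is blue. Starting from an initial blue set $B\subseteq V(G)$, a chronological list of forces is a sequence of valid forces performed one at a time until no further force is possible; its unordered set of forces is a set of forces of $B$. $B$ is a hopping forcing set if some chronological list turns every vertex blue. For a set of forces $\mathcal F$ of $B$, put $\mathcal F^{(0)}=B$ and, for $t>0$, let $\mathcal F^{(t)}$ be the set of vertices $w$ for which there is a force $v\to w$ in $\mathcal F$ with $v\in\bigcup_{i<t}\mathcal F^{(i)}$ that is a valid hopping force when exactly the vertices of $\bigcup_{i<t}\mathcal F^{(i)}$ are blue. $\mathrm{pt}_{\mathrm{H}}(G;\mathcal F)$ is the least $t$ with $\bigcup_{i\le t}\mathcal F^{(i)}=V(G)$, and $\mathrm{pt}_{\mathrm{H}}(G;B)$ is the minimum of $\mathrm{pt}_{\mathrm{H}}(G;\mathcal F)$ over sets of forces $\mathcal F$ of $B$ ($\infty$ if $B$ is not a hopping forcing set). The hopping throttling number is $\mathrm{th}_{\mathrm{H}}(G)=\min_{B\subseteq V(G)}\big(|B|+\mathrm{pt}_{\mathrm{H}}(G;B)\big)$. -}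

module Defs where

open import Data.Nat using (ℕ; zero; suc; _+_; _*_; _≤_; _<_)
open import Data.Fin using (Fin)
open import Data.Fin.Subset using (Subset; _∈_; _∉_; _∪_; ⁅_⁆; ∣_∣; ⊥)
open import Data.Bool using (Bool; true; false)
open import Data.List using (List; []; _∷_)
open import Data.List.Membership.Propositional using () renaming (_∈_ to _∈ₗ_)
open import Data.Product using (Σ; ∃; _×_; _,_)
open import Relation.Nullary using (¬_)
open import Relation.Binary.PropositionalEquality using (_≡_)

record Graph (n : ℕ) : Set where
  field
    adj        : Fin n → Fin n → Bool
    adj-sym    : ∀ u v → adj u v ≡ adj v u
    adj-irrefl : ∀ v → adj v v ≡ false

open Graph public

Adjacent : ∀ {n} → Graph n → Fin n → Fin n → Set
Adjacent G v u = adj G v u ≡ true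

NbhdIn : ∀ {n} → Graph n → Fin n → Subset n → Set
NbhdIn G v S = ∀ u → Adjacent G v u → u ∈ S

IsIndependent : ∀ {n} → Graph n → Subset n → Set
IsIndependent G S = ∀ u v → u ∈ S → v ∈ S → adj G u v ≡ false

IsIndependenceNumber : ∀ {n} → Graph n → ℕ → Set
IsIndependenceNumber G α =
  (Σ _ λ S → IsIndependent G S × ∣ S ∣ ≡ α) ×
  (∀ S → IsIndependent G S → ∣ S ∣ ≤ α)

Force : ℕ → Set
Force n = Fin n × Fin n   -- (v , w) means v → w

-- A hopping force v → w is valid when S is the blue set and `used`
-- is the set of vertices that have already performed a force.
ValidForce : ∀ {n} → Graph n → Subset n → Subset n → Fin n → Fin n → Set
ValidForce G S used v w = v ∈ S × w ∉ S × NbhdIn G v S × v ∉ used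

Terminal : ∀ {n} → Graph n → Subset n → Subset n → Set
Terminal G S used = ¬ (Σ _ λ v → Σ _ λ w → ValidForce G S used v w)

data ChronFrom {n : ℕ} (G : Graph n) : Subset n → Subset n → List (Force n) → Set where
  done  : ∀ {S used} → Terminal G S used → ChronFrom G S used []
  force : ∀ {S used v w rest} → ValidForce G S used v w →
          ChronFrom G (S ∪ ⁅ w ⁆) (used ∪ ⁅ v ⁆) rest →
          ChronFrom G S used ((v , w) ∷ rest)

-- L is a chronological list of forces of the initial blue set B.
-- (The set of forces of B determined by L is its set of entries; all
-- uses below only consult membership in L.)
ChronList : ∀ {n} → Graph n → Subset n → List (Force n) → Set
ChronList G B L = ChronFrom G B ⊥ L

-- InUpTo G B F t w :  w ∈ F⁽⁰⁾ ∪ … ∪ F⁽ᵗ⁾.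
data InUpTo {n : ℕ} (G : Graph n) (B : Subset n) (F : List (Force n)) : ℕ → Fin n → Set where
  base : ∀ {w} → w ∈ B → InUpTo G B F zero w
  keep : ∀ {t w} → InUpTo G B F t w → InUpTo G B F (suc t) w
  step : ∀ {t v w} → (v , w) ∈ₗ F → InUpTo G B F t v →
         (∀ u → Adjacent G v u → InUpTo G B F t u) →
         InUpTo G B F (suc t) w

AllBlueAt : ∀ {n} → Graph n → Subset n → List (Force n) → ℕ → Set
AllBlueAt G B F t = ∀ w → InUpTo G B F t w

IsPropTime : ∀ {n} → Graph n → Subset n → List (Force n) → ℕ → Set
IsPropTime G B F t = AllBlueAt G B F t × (∀ s → AllBlueAt G B F s → t ≤ s)

-- th_H(G) = m : minimum of |B| + pt_H(G;F) over B and sets of forces F of B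
-- (pairs with pt_H(G;F) = ∞ never attain the minimum).
IsHoppingThrottlingNumber : ∀ {n} → Graph n → ℕ → Set
IsHoppingThrottlingNumber G m =
  (Σ _ λ B → Σ _ λ F → Σ ℕ λ t → ChronList G B F × IsPropTime G B F t × ∣ B ∣ + t ≡ m) ×
  (∀ B F t → ChronList G B F → IsPropTime G B F t → m ≤ ∣ B ∣ + t)

-- k = ⌈2√α⌉, i.e. k is the least natural number with 4α ≤ k².

IsCeilTwoSqrt : ℕ → ℕ → Set
IsCeilTwoSqrt α k = 4 * α ≤ k * k × (∀ j → 4 * α ≤ j * j → k ≤ j)

-- Take a maximum independent set I and d, r with α ≤ (d+1)(r+1) and (d+1) + (r+1) ≤ ⌈2√α⌉.
-- Colour blue every vertex outside I together with the first b = d+1 vertices x₀, …, x_{b-1}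
-- of an enumeration of I, and let each xᵢ force x_{i+b}.  Every neighbour of a vertex of I lies
-- outside I and so is blue from the start; hence these are hopping forces, performed in order
-- they form a chronological list, and x_j is blue by time ⌊j/b⌋ ≤ r.  This costs at most
-- (n − α + b) + r = n − α − 1 + (d+1) + (r+1).

module Submission where

open import Defs
open import Data.Nat using (ℕ; zero; suc; _+_; _*_; _≤_; _<_; _∸_; _⊓_; z≤n; s≤s; s≤s⁻¹)
open import Data.Nat.Properties
open import Data.Fin using (Fin; zero; suc) renaming (_≟_ to _≟ᶠ_)
import Data.Fin.Properties as Fin
open import Data.Fin.Subset using (Subset; _∈_; _∉_; _∪_; ⁅_⁆; ∣_∣; ⊥; ∁; inside; outside)
open import Data.Fin.Subset.Properties
  using ( x∈p∪q⁺; x∈p∪q⁻; x∈⁅x⁆; x∈⁅y⁆⇒x≡y; x∉p⇒x∈∁p; x∈∁p⇒x∉p; ∉⊥; _∈?_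
        ; ∣∁p∣≡n∸∣p∣; ∣⁅x⁆∣≡1; ∣⊥∣≡0; ∣p∣≤n)
open import Data.Bool using (true)
import Data.Bool.Properties as Bool
open import Data.Vec using ([]; _∷_; here; there)
open import Data.List using (List; []; _∷_; map; length; take; drop; zip; _++_)
open import Data.List.Properties using (length-map; length-take; take-all; take++drop≡id)
open import Data.List.Membership.Propositional using (find; lose) renaming (_∈_ to _∈ₗ_; _∉_ to _∉ₗ_)
open import Data.List.Membership.Propositional.Properties using (∈-map⁺; ∈-map⁻; ∈-++⁻)
open import Data.List.Relation.Unary.Any using (Any; here; there; any?)
open import Data.List.Relation.Unary.All as All using (All)
open import Data.List.Relation.Unary.Unique.Propositional using (Unique; []; _∷_)
import Data.List.Relation.Unary.Unique.Propositional.Properties as Unique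
open import Data.List.Relation.Binary.Sublist.Propositional using (lookup)
open import Data.List.Relation.Binary.Sublist.Propositional.Properties using (take-⊆; drop-⊆; length-mono-≤)
open import Data.Product using (∃; ∃₂; _×_; _,_)
open import Data.Sum using (_⊎_; inj₁; inj₂)
import Data.Sum as Sum
open import Function using (_∘_)
open import Function.Bundles using (_⇔_; mk⇔; Equivalence)
open import Relation.Nullary using (Dec; yes; no; contradiction)
open import Relation.Nullary.Decidable using (map′; _×-dec_; _⊎-dec_; _→-dec_)
open import Relation.Unary using (Pred; Decidable)
open import Data.Nat.Tactic.RingSolver using (solve-∀)
open import Relation.Binary.PropositionalEquality using (_≡_; _≢_; refl; sym; trans; cong; subst)

private
  variable
    n : ℕ
    A : Set
    v : A

∈-take⁻ : ∀ k {xs : List A} → v ∈ₗ take k xs → v ∈ₗ xs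
∈-take⁻ k = lookup (take-⊆ k _)

∈-drop⁻ : ∀ k {xs : List A} → v ∈ₗ drop k xs → v ∈ₗ xs
∈-drop⁻ k = lookup (drop-⊆ k _)

∈-take-+⁻ : ∀ m k (xs : List A) → v ∈ₗ take (m + k) xs → v ∈ₗ take m xs ⊎ v ∈ₗ take k (drop m xs)
∈-take-+⁻ zero    k xs       v∈ = inj₂ v∈
∈-take-+⁻ (suc m) k (x ∷ xs) (here refl) = inj₁ (here refl)
∈-take-+⁻ (suc m) k (x ∷ xs) (there v∈) = Sum.map₁ there (∈-take-+⁻ m k xs v∈)

Unique⇒take-drop-disjoint : ∀ k {xs : List A} → Unique xs → v ∈ₗ take k xs → v ∉ₗ drop k xs
Unique⇒take-drop-disjoint (suc k) {x ∷ xs} x∷xs! (here refl) = Unique.Unique[x∷xs]⇒x∉xs x∷xs! ∘ ∈-drop⁻ k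
Unique⇒take-drop-disjoint (suc k) {x ∷ xs} (_ ∷ xs!) (there v∈) = Unique⇒take-drop-disjoint k xs! v∈

zip-partner : ∀ k (xs ys : List A) → length ys ≤ length xs → v ∈ₗ take k ys →
              ∃ λ u → u ∈ₗ take k xs × (u , v) ∈ₗ zip xs ys
zip-partner (suc k) (x ∷ xs) (y ∷ ys) _         (here refl) = x , here refl , here refl
zip-partner (suc k) (x ∷ xs) (y ∷ ys) (s≤s ys≤) (there v∈)  with zip-partner k xs ys ys≤ v∈
... | u , u∈ , uv∈ = u , there u∈ , there uv∈

drop-suc : ∀ d {xs : List A} {y ys} → drop d xs ≡ y ∷ ys → drop (suc d) xs ≡ ys
drop-suc zero    refl = refl
drop-suc (suc d) {x ∷ xs} eq = drop-suc d eq

∣p∪q∣≤∣p∣+∣q∣ : ∀ (p q : Subset n) → ∣ p ∪ q ∣ ≤ ∣ p ∣ + ∣ q ∣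
∣p∪q∣≤∣p∣+∣q∣ []            []            = z≤n
∣p∪q∣≤∣p∣+∣q∣ (inside ∷ p)  (inside ∷ q)  =
  s≤s (≤-trans (∣p∪q∣≤∣p∣+∣q∣ p q) (+-monoʳ-≤ ∣ p ∣ (n≤1+n _)))
∣p∪q∣≤∣p∣+∣q∣ (inside ∷ p)  (outside ∷ q) = s≤s (∣p∪q∣≤∣p∣+∣q∣ p q)
∣p∪q∣≤∣p∣+∣q∣ (outside ∷ p) (inside ∷ q)  =
  subst (suc ∣ p ∪ q ∣ ≤_) (sym (+-suc ∣ p ∣ ∣ q ∣)) (s≤s (∣p∪q∣≤∣p∣+∣q∣ p q))
∣p∪q∣≤∣p∣+∣q∣ (outside ∷ p) (outside ∷ q) = ∣p∪q∣≤∣p∣+∣q∣ p q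

toList : Subset n → List (Fin n)
toList []            = []
toList (inside ∷ p)  = zero ∷ map suc (toList p)
toList (outside ∷ p) = map suc (toList p)

length-toList : ∀ (p : Subset n) → length (toList p) ≡ ∣ p ∣
length-toList []            = refl
length-toList (inside ∷ p)  = cong suc (trans (length-map suc (toList p)) (length-toList p))
length-toList (outside ∷ p) = trans (length-map suc (toList p)) (length-toList p)

∈-toList⁺ : ∀ {p : Subset n} {x} → x ∈ p → x ∈ₗ toList p
∈-toList⁺ {p = inside ∷ p}  here      = here refl
∈-toList⁺ {p = inside ∷ p}  (there x∈) = there (∈-map⁺ suc (∈-toList⁺ x∈))
∈-toList⁺ {p = outside ∷ p} (there x∈) = ∈-map⁺ suc (∈-toList⁺ x∈)

∈-toList⁻ : ∀ (p : Subset n) {x} → x ∈ₗ toList p → x ∈ p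
∈-toList⁻ (inside ∷ p)  (here refl) = here
∈-toList⁻ (inside ∷ p)  (there x∈) with ∈-map⁻ suc x∈
... | _ , y∈ , refl = there (∈-toList⁻ p y∈)
∈-toList⁻ (outside ∷ p) x∈ with ∈-map⁻ suc x∈
... | _ , y∈ , refl = there (∈-toList⁻ p y∈)

toList-Unique : ∀ (p : Subset n) → Unique (toList p)
toList-Unique []            = []
toList-Unique (inside ∷ p)  = All.tabulate zero∉ ∷ Unique.map⁺ Fin.suc-injective (toList-Unique p)
  where
  zero∉ : ∀ {x} → x ∈ₗ map suc (toList p) → zero ≢ x
  zero∉ x∈ refl with ∈-map⁻ suc x∈
  ... | _ , _ , ()
toList-Unique (outside ∷ p) = Unique.map⁺ Fin.suc-injective (toList-Unique p)

ComplementOf : List (Fin n) → Subset n → Set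
ComplementOf ys S = ∀ v → v ∈ S ⇔ v ∉ₗ ys

ComplementOf-∷ : ∀ {S : Subset n} {y ys} → ComplementOf (y ∷ ys) S → y ∉ₗ ys → ComplementOf ys (S ∪ ⁅ y ⁆)
ComplementOf-∷ {S = S} {y} {ys} S=∁ y∉ys v = mk⇔ to from
  where
  to : v ∈ S ∪ ⁅ y ⁆ → v ∉ₗ ys
  to v∈ with x∈p∪q⁻ S ⁅ y ⁆ v∈
  ... | inj₁ v∈S = Equivalence.to (S=∁ v) v∈S ∘ there
  ... | inj₂ v∈y rewrite x∈⁅y⁆⇒x≡y y v∈y = y∉ys
  from : v ∉ₗ ys → v ∈ S ∪ ⁅ y ⁆
  from v∉ys with v ≟ᶠ y
  ... | yes refl = x∈p∪q⁺ (inj₂ (x∈⁅x⁆ y))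
  ... | no v≢y = x∈p∪q⁺ (inj₁ (Equivalence.from (S=∁ v) λ
    { (here v≡y) → v≢y v≡y ; (there v∈ys) → v∉ys v∈ys }))

fromList : List (Fin n) → Subset n
fromList []       = ⊥
fromList (x ∷ xs) = ⁅ x ⁆ ∪ fromList xs

∈-fromList⁺ : ∀ {xs : List (Fin n)} {x} → x ∈ₗ xs → x ∈ fromList xs
∈-fromList⁺ {xs = y ∷ ys} (here refl) = x∈p∪q⁺ (inj₁ (x∈⁅x⁆ y))
∈-fromList⁺ {xs = y ∷ ys} (there x∈) = x∈p∪q⁺ (inj₂ (∈-fromList⁺ x∈))

∈-fromList⁻ : ∀ (xs : List (Fin n)) {x} → x ∈ fromList xs → x ∈ₗ xs
∈-fromList⁻ []       x∈ = contradiction x∈ ∉⊥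
∈-fromList⁻ (y ∷ ys) x∈ with x∈p∪q⁻ ⁅ y ⁆ (fromList ys) x∈
... | inj₁ x∈y  = here (x∈⁅y⁆⇒x≡y y x∈y)
... | inj₂ x∈ys = there (∈-fromList⁻ ys x∈ys)

∣fromList∣≤length : ∀ (xs : List (Fin n)) → ∣ fromList xs ∣ ≤ length xs
∣fromList∣≤length {n} []       = ≤-reflexive (∣⊥∣≡0 n)
∣fromList∣≤length (x ∷ xs)     = begin
  ∣ ⁅ x ⁆ ∪ fromList xs ∣       ≤⟨ ∣p∪q∣≤∣p∣+∣q∣ ⁅ x ⁆ (fromList xs) ⟩
  ∣ ⁅ x ⁆ ∣ + ∣ fromList xs ∣   ≡⟨ cong (_+ ∣ fromList xs ∣) (∣⁅x⁆∣≡1 x) ⟩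
  suc ∣ fromList xs ∣           ≤⟨ s≤s (∣fromList∣≤length xs) ⟩
  suc (length xs)               ∎
  where open ≤-Reasoning

least-witness : ∀ {p} {P : Pred ℕ p} → Decidable P →
                ∀ {r} → P r → ∃ λ t → P t × (∀ {s} → P s → t ≤ s)
least-witness {P = P} P? {r} Pr with P? 0
... | yes P0 = 0 , P0 , λ _ → z≤n
... | no ¬P0 with r
...   | zero  = contradiction Pr ¬P0
...   | suc r with least-witness {P = P ∘ suc} (P? ∘ suc) Pr
...     | t , Pt , t-least = suc t , Pt , least
  where
  least : ∀ {s} → P s → suc t ≤ s
  least {zero}  P0 = contradiction P0 ¬P0
  least {suc s} Ps = s≤s (t-least Ps)

even-or-odd : ∀ k → ∃ λ h → k ≡ h + h ⊎ k ≡ suc (h + h)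
even-or-odd zero = 0 , inj₁ refl
even-or-odd (suc k) with even-or-odd k
... | h , inj₁ refl = h , inj₂ refl
... | h , inj₂ refl = suc h , inj₁ (cong suc (sym (+-suc h h)))

balanced-factors : ∀ {α k} → 1 ≤ α → 4 * α ≤ k * k →
                   ∃₂ λ d r → α ≤ suc d * suc r × suc d + suc r ≤ k
balanced-factors {α} {k} 1≤α 4α≤k² with even-or-odd k
... | zero , inj₁ refl = contradiction (≤-trans (*-monoʳ-≤ 4 1≤α) 4α≤k²) λ ()
... | zero , inj₂ refl = contradiction (≤-trans (*-monoʳ-≤ 4 1≤α) 4α≤k²) λ { (s≤s ()) }
... | suc d , inj₁ refl =
  d , d , *-cancelˡ-≤ 4 (subst (4 * α ≤_) (square-even (suc d)) 4α≤k²) , ≤-refl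
  where
  square-even : ∀ h → (h + h) * (h + h) ≡ 4 * (h * h)
  square-even = solve-∀
... | suc d , inj₂ refl =
  d , suc d , s≤s⁻¹ (*-cancelˡ-< 4 α _ 4α<4[m+1]) , ≤-reflexive (cong suc (+-suc d (suc d)))
  where
  square-odd : ∀ h → suc (h + h) * suc (h + h) ≡ suc (4 * (h * suc h))
  square-odd = solve-∀
  m = suc d * suc (suc d)
  4α<4[m+1] : 4 * α < 4 * suc m
  4α<4[m+1] = begin-strict
    4 * α          ≤⟨ subst (4 * α ≤_) (square-odd (suc d)) 4α≤k² ⟩
    1 + 4 * m      <⟨ +-monoˡ-< (4 * m) {1} {4} (s≤s (s≤s z≤n)) ⟩
    4 + 4 * m      ≡⟨ sym (*-suc 4 m) ⟩
    4 * suc m      ∎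
    where open ≤-Reasoning

singleton-independent : ∀ (G : Graph n) x → IsIndependent G ⁅ x ⁆
singleton-independent G x u w u∈ w∈ with x∈⁅y⁆⇒x≡y x u∈ | x∈⁅y⁆⇒x≡y x w∈
... | refl | refl = adj-irrefl G x

IsIndependenceNumber⇒1≤α : ∀ (G : Graph (suc n)) {α} → IsIndependenceNumber G α → 1 ≤ α
IsIndependenceNumber⇒1≤α {n} G {α} (_ , α-maximum) =
  subst (_≤ α) (∣⁅x⁆∣≡1 {n = suc n} zero) (α-maximum ⁅ zero ⁆ (singleton-independent G zero))

hopForces : ℕ → List (Fin n) → List (Force n)
hopForces b xs = zip xs (drop b xs)

module _ (G : Graph n) where

  all-blue⇒Terminal : ∀ {S used} → (∀ v → v ∈ S) → Terminal G S used
  all-blue⇒Terminal all-blue (_ , w , _ , w∉S , _) = w∉S (all-blue w)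

  module _ {B : Subset n} {F : List (Force n)} where

    initially-blue : ∀ {t w} → w ∈ B → InUpTo G B F t w
    initially-blue {zero}  w∈B = base w∈B
    initially-blue {suc t} w∈B = keep (initially-blue w∈B)

    InUpTo? : ∀ t w → Dec (InUpTo G B F t w)
    InUpTo? zero    w = map′ base (λ { (base w∈B) → w∈B }) (w ∈? B)
    InUpTo? (suc t) w = map′ to from (InUpTo? t w ⊎-dec any? forced? F)
      where
      ForcedBy : Force n → Set
      ForcedBy (v , w′) = w′ ≡ w × InUpTo G B F t v × (∀ u → Adjacent G v u → InUpTo G B F t u)

      forced? : ∀ f → Dec (ForcedBy f)
      forced? (v , w′) =
        (w′ ≟ᶠ w) ×-dec InUpTo? t v ×-dec Fin.all? (λ u → (adj G v u Bool.≟ true) →-dec InUpTo? t u)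

      to : InUpTo G B F t w ⊎ Any ForcedBy F → InUpTo G B F (suc t) w
      to (inj₁ blue) = keep blue
      to (inj₂ any) with find any
      ... | _ , vw∈F , refl , v-blue , N[v]-blue = step vw∈F v-blue N[v]-blue

      from : InUpTo G B F (suc t) w → InUpTo G B F t w ⊎ Any ForcedBy F
      from (keep blue)                 = inj₁ blue
      from (step vw∈F v-blue N[v]-blue) = inj₂ (lose vw∈F (refl , v-blue , N[v]-blue))

    propagation-time : ∀ {r} → AllBlueAt G B F r → ∃ λ t → IsPropTime G B F t × t ≤ r
    propagation-time all-blue with least-witness (λ t → Fin.all? (InUpTo? t)) all-blue
    ... | t , all-blue-at-t , t-least = t , (all-blue-at-t , λ _ → t-least) , t-least all-blue

  module _ {I : Subset n} (I-independent : IsIndependent G I) where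

    adjacent⇒∉ : ∀ {v u} → v ∈ I → Adjacent G v u → u ∉ I
    adjacent⇒∉ v∈I v~u u∈I = contradiction (trans (sym v~u) (I-independent _ _ v∈I u∈I)) λ ()

    hopForces-chronological : ∀ d xs {S used} → Unique xs → (∀ {v} → v ∈ₗ xs → v ∈ I) →
      ComplementOf (drop (suc d) xs) S → (∀ {v} → v ∈ₗ xs → v ∉ used) →
      ChronFrom G S used (hopForces (suc d) xs)
    hopForces-chronological d [] _ _ S=∁ _ = done (all-blue⇒Terminal λ v → Equivalence.from (S=∁ v) λ ())
    hopForces-chronological d (x ∷ xs) {S} {used} x∷xs!@(_ ∷ xs!) xs⊆I S=∁ unused with drop d xs in eq
    ... | [] = done (all-blue⇒Terminal λ v → Equivalence.from (S=∁ v) λ ())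
    ... | y ∷ ys = force (x∈S , y∉S , N[x]⊆S , unused (here refl))
      (subst (ChronFrom G (S ∪ ⁅ y ⁆) (used ∪ ⁅ x ⁆) ∘ zip xs) (drop-suc d eq)
        (hopForces-chronological d xs xs! (xs⊆I ∘ there) S∪y=∁ unused′))
      where
      x∉xs : x ∉ₗ xs
      x∉xs = Unique.Unique[x∷xs]⇒x∉xs x∷xs!
      ∈y∷ys⇒∈xs : ∀ {v} → v ∈ₗ y ∷ ys → v ∈ₗ xs
      ∈y∷ys⇒∈xs = ∈-drop⁻ d ∘ subst (_ ∈ₗ_) (sym eq)
      x∈S : x ∈ S
      x∈S = Equivalence.from (S=∁ x) (x∉xs ∘ ∈y∷ys⇒∈xs)
      y∉S : y ∉ S
      y∉S y∈S = Equivalence.to (S=∁ y) y∈S (here refl)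
      N[x]⊆S : NbhdIn G x S
      N[x]⊆S u x~u =
        Equivalence.from (S=∁ u) (adjacent⇒∉ (xs⊆I (here refl)) x~u ∘ xs⊆I ∘ there ∘ ∈y∷ys⇒∈xs)
      S∪y=∁ : ComplementOf (drop (suc d) xs) (S ∪ ⁅ y ⁆)
      S∪y=∁ = subst (λ zs → ComplementOf zs (S ∪ ⁅ y ⁆)) (sym (drop-suc d eq))
        (ComplementOf-∷ S=∁ (Unique.Unique[x∷xs]⇒x∉xs (subst Unique eq (Unique.drop⁺ (suc d) x∷xs!))))
      unused′ : ∀ {v} → v ∈ₗ xs → v ∉ used ∪ ⁅ x ⁆
      unused′ v∈xs v∈ with x∈p∪q⁻ used ⁅ x ⁆ v∈
      ... | inj₁ v∈used = unused (there v∈xs) v∈used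
      ... | inj₂ v∈x rewrite x∈⁅y⁆⇒x≡y x v∈x = x∉xs v∈xs

    module _ (b : ℕ) (xs : List (Fin n)) {B : Subset n}
             (xs⊆I : ∀ {v} → v ∈ₗ xs → v ∈ I) (∁I⊆B : ∀ {v} → v ∉ I → v ∈ B)
             (seeds⊆B : ∀ {v} → v ∈ₗ take b xs → v ∈ B) where

      hopForces-blue-by : ∀ t {v} → v ∈ₗ take (b * suc t) xs → InUpTo G B (hopForces b xs) t v
      hopForces-blue-by zero {v} v∈ = base (seeds⊆B (subst (λ m → v ∈ₗ take m xs) (*-identityʳ b) v∈))
      hopForces-blue-by (suc t) {v} v∈
        with ∈-take-+⁻ b (b * suc t) xs (subst (λ m → v ∈ₗ take m xs) (*-suc b (suc t)) v∈)
      ... | inj₁ v∈seeds = initially-blue (seeds⊆B v∈seeds)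
      ... | inj₂ v∈later with zip-partner (b * suc t) xs (drop b xs) (length-mono-≤ (drop-⊆ b xs)) v∈later
      ...   | u , u∈ , uv∈F = step uv∈F (hopForces-blue-by t u∈) N[u]-blue
        where
        N[u]-blue : ∀ w → Adjacent G u w → InUpTo G B (hopForces b xs) t w
        N[u]-blue w u~w = initially-blue (∁I⊆B (adjacent⇒∉ (xs⊆I (∈-take⁻ _ u∈)) u~w))

    interleaved-chains : ∀ d r → ∣ I ∣ ≤ suc d * suc r →
      ∃₂ λ B F → ChronList G B F × AllBlueAt G B F r × ∣ B ∣ ≤ (n ∸ ∣ I ∣) + suc d
    interleaved-chains d r ∣I∣≤ = B , hopForces b xs , chronological , all-blue , ∣B∣≤
      where
      b = suc d
      xs = toList I
      B = ∁ I ∪ fromList (take b xs)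

      xs⊆I : ∀ {v} → v ∈ₗ xs → v ∈ I
      xs⊆I = ∈-toList⁻ I
      ∁I⊆B : ∀ {v} → v ∉ I → v ∈ B
      ∁I⊆B = x∈p∪q⁺ ∘ inj₁ ∘ x∉p⇒x∈∁p
      seeds⊆B : ∀ {v} → v ∈ₗ take b xs → v ∈ B
      seeds⊆B = x∈p∪q⁺ ∘ inj₂ ∘ ∈-fromList⁺

      B=∁ : ComplementOf (drop b xs) B
      B=∁ v = mk⇔ to from
        where
        to : v ∈ B → v ∉ₗ drop b xs
        to v∈B with x∈p∪q⁻ (∁ I) _ v∈B
        ... | inj₁ v∈∁I   = x∈∁p⇒x∉p v∈∁I ∘ xs⊆I ∘ ∈-drop⁻ b
        ... | inj₂ v∈seed = Unique⇒take-drop-disjoint b (toList-Unique I) (∈-fromList⁻ _ v∈seed)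
        from : v ∉ₗ drop b xs → v ∈ B
        from v∉later with v ∈? I
        ... | no v∉I  = ∁I⊆B v∉I
        ... | yes v∈I with ∈-++⁻ (take b xs) (subst (v ∈ₗ_) (sym (take++drop≡id b xs)) (∈-toList⁺ v∈I))
        ...   | inj₁ v∈seeds = seeds⊆B v∈seeds
        ...   | inj₂ v∈later = contradiction v∈later v∉later

      chronological : ChronList G B (hopForces b xs)
      chronological = hopForces-chronological d xs (toList-Unique I) xs⊆I B=∁ (λ _ → ∉⊥)

      all-blue : AllBlueAt G B (hopForces b xs) r
      all-blue v with v ∈? I
      ... | no v∉I  = initially-blue (∁I⊆B v∉I)
      ... | yes v∈I = hopForces-blue-by b xs xs⊆I ∁I⊆B seeds⊆B r
        (subst (v ∈ₗ_) (sym (take-all _ xs length≤)) (∈-toList⁺ v∈I))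
        where
        length≤ : length xs ≤ b * suc r
        length≤ = subst (_≤ b * suc r) (sym (length-toList I)) ∣I∣≤

      ∣B∣≤ : ∣ B ∣ ≤ (n ∸ ∣ I ∣) + b
      ∣B∣≤ = begin
        ∣ B ∣                                   ≤⟨ ∣p∪q∣≤∣p∣+∣q∣ (∁ I) _ ⟩
        ∣ ∁ I ∣ + ∣ fromList (take b xs) ∣      ≤⟨ +-mono-≤ (≤-reflexive (∣∁p∣≡n∸∣p∣ I))
                                                             (∣fromList∣≤length (take b xs)) ⟩
        (n ∸ ∣ I ∣) + length (take b xs)        ≡⟨ cong ((n ∸ ∣ I ∣) +_) (length-take b xs) ⟩
        (n ∸ ∣ I ∣) + (b ⊓ length xs)           ≤⟨ +-monoʳ-≤ (n ∸ ∣ I ∣) (m⊓n≤m b _) ⟩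
        (n ∸ ∣ I ∣) + b                         ∎
        where open ≤-Reasoning

proposition3p11 : ∀ {n} (G : Graph n) (α th k : ℕ) →
    1 ≤ n →
    IsIndependenceNumber G α →
    IsHoppingThrottlingNumber G th →
    IsCeilTwoSqrt α k →
    -- th_H(G) ≤ n - α - 1 + ⌈2√α⌉ = ⌈n - α + 2√α - 1⌉
    th + α + 1 ≤ n + k
proposition3p11 {n@(suc _)} G α th k _ α-indep@((I , I-independent , ∣I∣≡α) , _) (_ , th-minimum) (4α≤k² , _)
  with balanced-factors (IsIndependenceNumber⇒1≤α G α-indep) 4α≤k²
... | d , r , α≤[d+1][r+1] , d+1+r+1≤k
  with interleaved-chains G I-independent d r (subst (_≤ suc d * suc r) (sym ∣I∣≡α) α≤[d+1][r+1])
... | B , F , chronological , all-blue , ∣B∣≤ with propagation-time G all-blue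
... | t , propTime , t≤r = begin
  th + α + 1                           ≤⟨ +-monoˡ-≤ 1 (+-monoˡ-≤ α th≤) ⟩
  (n ∸ α) + suc d + r + α + 1          ≡⟨ regroup (n ∸ α) (suc d) r α ⟩
  ((n ∸ α) + α) + (suc d + suc r)      ≡⟨ cong (_+ (suc d + suc r)) (m∸n+n≡m α≤n) ⟩
  n + (suc d + suc r)                  ≤⟨ +-monoʳ-≤ n d+1+r+1≤k ⟩
  n + k                                ∎
  where
  open ≤-Reasoning
  regroup : ∀ x b r a → x + b + r + a + 1 ≡ (x + a) + (b + suc r)
  regroup = solve-∀
  α≤n : α ≤ n
  α≤n = subst (_≤ n) ∣I∣≡α (∣p∣≤n I)
  th≤ : th ≤ (n ∸ α) + suc d + r
  th≤ = ≤-trans (th-minimum B F t chronological propTime)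
    (+-mono-≤ (subst (λ a → ∣ B ∣ ≤ (n ∸ a) + suc d) ∣I∣≡α ∣B∣≤) t≤r)
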